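{- The emptiness problem is decidable for effective generalized pushdown automata: there is a procedure which, given an effective GPA $\mathcal{P}$ (with access to the decision procedures witnessing its effectiveness), decides whether $L(\mathcal{P})=\emptyset$.
   Context: For a finite alphabet $X$, $X_\epsilon = X\cup\{\epsilon\}$. A finite state automaton (FSA) over $\Gamma$ is a standard nondeterministic finite automaton (with $\epsilon$-transitions allowed) with language $L(\cdot)$. A generalized pushdown automaton (GPA) is a tuple $\mathcal{P}=(P,\Sigma,\Gamma,\delta,p_0,\gamma_0,F)$ where $P$ is a finite nonempty set of states, $\Sigma$ an input alphabet, $\Gamma$ a stack alphabet, $\delta: P\times\Gamma\times\Sigma_\epsilon\times P\to 2^{\Gamma^*}$ assigns to each tuple a (possibly infinite) language over $\Gamma$, $p_0\in P$ the initial state, $\gamma_0\in\Gamma$ the initial stack symbol, $F\subseteq P$ the final states. Configurations are pairs $(p,w)\in P\times\Gamma^*$; there is a step $(p,\gamma w)\xrightarrow{a}(p',uw)$ whenever $u\in\delta(p,\gamma,a,p')$ and $w\in\Gamma^*$. The language $L(\mathcal{P})$ is the set of words $\tau\in\Sigma^*$ such that $(p_0,\gamma_0)$ reaches some configuration $(p,\epsilon)$ with $p\in F$ by a finite sequence of steps whose concatenated labels equal $\tau$. $\mathcal{P}$ is effective if for every FSA $\mathcal{B}$ over $\Gamma$ it is decidable whether $L(\mathcal{B})\cap\delta(p,\gamma,a,p')\neq\emptyset$, for all $p,p'\in P$, $\gamma\in\Gamma$, $a\in\Sigma_\epsilon$. -}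

module Defs where

open import Data.Nat using (ℕ)
open import Data.Fin using (Fin)
open import Data.Bool using (Bool; true)
open import Data.Maybe using (Maybe; just; nothing)
open import Data.List using (List; []; _∷_; _++_)
open import Data.Product using (Σ; ∃; _×_; _,_)
open import Relation.Binary.PropositionalEquality using (_≡_)
open import Relation.Nullary using (Dec; ¬_)

-- Finite alphabets are Fin n.  Σ_ε = Maybe Σ (nothing = ε).

record FSA (nΓ : ℕ) : Set where
  field
    nQ    : ℕ
    init  : Fin nQ
    final : Fin nQ → Bool
    trans : Fin nQ → Maybe (Fin nΓ) → Fin nQ → Bool

module _ {nΓ : ℕ} (B : FSA nΓ) where
  open FSA B

  data Reach : Fin nQ → List (Fin nΓ) → Fin nQ → Set where
    done  : ∀ {q} → Reach q [] q
    stepε : ∀ {q q' w r} → trans q nothing q' ≡ true → Reach q' w r → Reach q w r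
    stepa : ∀ {q q' a w r} → trans q (just a) q' ≡ true → Reach q' w r → Reach q (a ∷ w) r

  Accepts : List (Fin nΓ) → Set
  Accepts w = ∃ λ q → final q ≡ true × Reach init w q

record GPA : Set₁ where
  field
    nP  : ℕ
    nΣ  : ℕ
    nΓ  : ℕ
    δ   : Fin nP → Fin nΓ → Maybe (Fin nΣ) → Fin nP → List (Fin nΓ) → Set
                     -- δ(p,γ,a,p') as a (possibly infinite) language over Γ
    p₀  : Fin nP
    γ₀  : Fin nΓ
    F   : Fin nP → Bool

module _ (𝒫 : GPA) where
  open GPA 𝒫

  Config : Set
  Config = Fin nP × List (Fin nΓ)

  data Step : Config → Maybe (Fin nΣ) → Config → Set where
    step : ∀ {p γ a p' u w} → δ p γ a p' u → Step (p , γ ∷ w) a (p' , u ++ w)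

  data Steps : Config → List (Fin nΣ) → Config → Set where
    done  : ∀ {c} → Steps c [] c
    stepε : ∀ {c c' τ d} → Step c nothing c' → Steps c' τ d → Steps c τ d
    stepa : ∀ {c c' a τ d} → Step c (just a) c' → Steps c' τ d → Steps c (a ∷ τ) d

  InLang : List (Fin nΣ) → Set
  InLang τ = ∃ λ p → F p ≡ true × Steps (p₀ , γ₀ ∷ []) τ (p , [])

  LangEmpty : Set
  LangEmpty = ∀ τ → ¬ InLang τ

  Effective : Set
  Effective = (B : FSA nΓ) → ∀ p γ a p' →
              Dec (∃ λ u → Accepts B u × δ p γ a p' u)

-- Call a triple (p, γ, m) a pop summary when, from state p with γ on top of
-- the stack, the automaton can reach state m with γ popped, whatever lies
-- below.  The pop summaries form the least set S of triples that contains
-- (p, γ, m) whenever some u ∈ δ(p, γ, a, q) can be consumed from q to m by a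
-- chain of summaries in S; such chains are exactly the words accepted by the
-- finite automaton on P whose γ-edges x → y are the triples (x, γ, y) ∈ S.
-- Effectiveness makes each saturation step decidable, there are only finitely
-- many triples, and L(𝒫) ≠ ∅ iff (p₀, γ₀, p) is a pop summary for a final p.
module Submission where

open import Defs
open import Data.Bool using (Bool; true; false)
open import Data.Bool.Properties using () renaming (_≟_ to _≟ᵇ_)
open import Data.Empty using (⊥-elim)
open import Data.Fin using (Fin; combine; remQuot)
open import Data.Fin.Properties using (any?; remQuot-combine) renaming (_≟_ to _≟ᶠ_)
open import Data.Fin.Subset using (Subset; _∈_; _∉_; _⊂_; _⊃_; _∪_; ⁅_⁆; ⊥)
open import Data.Fin.Subset.Induction using (⊃-wellFounded)
open import Data.Fin.Subset.Properties using (_∈?_; ∉⊥; x∈⁅x⁆; x∈⁅y⁆⇒x≡y; p⊆p∪q; q⊆p∪q; x∈p∪q⁻)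
open import Data.List using ([]; _∷_; _++_; fromMaybe)
open import Data.Maybe using (Maybe; just; nothing)
open import Data.Nat using (ℕ; _*_)
open import Data.Product using (∃; ∃₂; _×_; _,_; map₂)
open import Data.Sum using (inj₁; inj₂)
open import Induction.WellFounded using (Acc; acc)
open import Relation.Binary.PropositionalEquality using (_≡_; refl; sym; cong; subst; module ≡-Reasoning)
open import Relation.Nullary using (Dec; yes; no; does)
open import Relation.Nullary.Decidable using (_×-dec_; ¬?; map′; dec-true; decidable-stable)

does-true⇒ : ∀ {a} {A : Set a} (a? : Dec A) → does a? ≡ true → A
does-true⇒ (yes a) _ = a

any-Maybe? : ∀ {n p} {P : Maybe (Fin n) → Set p} → (∀ a → Dec (P a)) → Dec (∃ P)
any-Maybe? P? with P? nothing | any? (λ a → P? (just a))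
... | yes p | _ = yes (nothing , p)
... | no _ | yes (a , p) = yes (just a , p)
... | no ¬p | no ¬q = no λ { (nothing , p) → ¬p p ; (just a , p) → ¬q (a , p) }

x∉p⇒p⊂p∪⁅x⁆ : ∀ {n} {x : Fin n} {p : Subset n} → x ∉ p → p ⊂ p ∪ ⁅ x ⁆
x∉p⇒p⊂p∪⁅x⁆ {x = x} {p} x∉p = p⊆p∪q ⁅ x ⁆ , x , q⊆p∪q p ⁅ x ⁆ (x∈⁅x⁆ x) , x∉p

module Saturation {n : ℕ}
  (Derivable : Subset n → Fin n → Set)
  (derivable? : ∀ S i → Dec (Derivable S i))
  (Good : Fin n → Set)
  where

  AllGood : Subset n → Set
  AllGood S = ∀ {i} → i ∈ S → Good i

  Saturated : Subset n → Set
  Saturated S = ∀ {i} → Derivable S i → i ∈ S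

  module _ (derivable-good : ∀ {S i} → AllGood S → Derivable S i → Good i) where

    saturate : ∀ S → AllGood S → ∃ λ S′ → AllGood S′ × Saturated S′
    saturate S good = go S good (⊃-wellFounded S)
      where
      go : ∀ S → AllGood S → Acc _⊃_ S → ∃ λ S′ → AllGood S′ × Saturated S′
      go S good (acc rec) with any? (λ i → ¬? (i ∈? S) ×-dec derivable? S i)
      ... | yes (i , i∉S , d) = go (S ∪ ⁅ i ⁆) good′ (rec (x∉p⇒p⊂p∪⁅x⁆ i∉S))
        where
        good′ : AllGood (S ∪ ⁅ i ⁆)
        good′ {j} j∈S∪i with x∈p∪q⁻ S ⁅ i ⁆ j∈S∪i
        ... | inj₁ j∈S = good j∈S
        ... | inj₂ j∈⁅i⁆ = subst Good (sym (x∈⁅y⁆⇒x≡y i j∈⁅i⁆)) (derivable-good good d)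
      ... | no none = S , good , λ {i} d → decidable-stable (i ∈? S) (λ i∉S → none (i , i∉S , d))

Reach-split : ∀ {nΓ} {B : FSA nΓ} {x y} u {w} → Reach B x (u ++ w) y →
              ∃ λ z → Reach B x u z × Reach B z w y
Reach-split []      r           = _ , done , r
Reach-split (γ ∷ u) (stepε e r) with Reach-split (γ ∷ u) r
... | z , r₁ , r₂ = z , stepε e r₁ , r₂
Reach-split (γ ∷ u) (stepa e r) with Reach-split u r
... | z , r₁ , r₂ = z , stepa e r₁ , r₂

module _ (𝒫 : GPA) where
  open GPA 𝒫
  open ≡-Reasoning

  private
    Steps′ = Steps 𝒫

  _◅_ : ∀ {c a c′ τ d} → Step 𝒫 c a c′ → Steps′ c′ τ d → Steps′ c (fromMaybe a ++ τ) d
  _◅_ {a = nothing} s r = stepε s r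
  _◅_ {a = just _}  s r = stepa s r

  _◅◅_ : ∀ {c τ d τ′ e} → Steps′ c τ d → Steps′ d τ′ e → Steps′ c (τ ++ τ′) e
  done      ◅◅ r′ = r′
  stepε s r ◅◅ r′ = stepε s (r ◅◅ r′)
  stepa s r ◅◅ r′ = stepa s (r ◅◅ r′)

  Triple : Set
  Triple = Fin nP × Fin nΓ × Fin nP

  N : ℕ
  N = nP * (nΓ * nP)

  encode : Triple → Fin N
  encode (p , γ , m) = combine p (combine γ m)

  decode : Fin N → Triple
  decode i = map₂ (remQuot nP) (remQuot (nΓ * nP) i)

  decode-encode : ∀ t → decode (encode t) ≡ t
  decode-encode (p , γ , m) = begin
    map₂ (remQuot nP) (remQuot (nΓ * nP) (combine p (combine γ m)))  ≡⟨ cong (map₂ (remQuot nP)) (remQuot-combine p _) ⟩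
    p , remQuot nP (combine γ m)                                      ≡⟨ cong (p ,_) (remQuot-combine γ m) ⟩
    p , γ , m                                                         ∎

  PopSummary : Triple → Set
  PopSummary (p , γ , m) = ∀ w → ∃ λ τ → Steps′ (p , γ ∷ w) τ (m , w)

  summaryFSA : Subset N → Fin nP → Fin nP → FSA nΓ
  summaryFSA S q m = record { nQ = nP ; init = q ; final = λ x → does (x ≟ᶠ m) ; trans = edge }
    where
    edge : Fin nP → Maybe (Fin nΓ) → Fin nP → Bool
    edge x nothing  y = false
    edge x (just γ) y = does (encode (x , γ , y) ∈? S)

  Reach-retarget : ∀ {S q m q′ m′ x u y} → Reach (summaryFSA S q m) x u y → Reach (summaryFSA S q′ m′) x u y
  Reach-retarget done        = done
  Reach-retarget (stepa e r) = stepa e (Reach-retarget r)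

  Derivable : Subset N → Triple → Set
  Derivable S (p , γ , m) = ∃₂ λ a q → ∃ λ u → Accepts (summaryFSA S q m) u × δ p γ a q u

  derivable? : Effective 𝒫 → ∀ S t → Dec (Derivable S t)
  derivable? eff S (p , γ , m) = any-Maybe? λ a → any? λ q → eff (summaryFSA S q m) p γ a q

  Sound : Subset N → Set
  Sound S = ∀ t → encode t ∈ S → PopSummary t

  Closed : Subset N → Set
  Closed S = ∀ t → Derivable S t → encode t ∈ S

  Reach-pops : ∀ {S q m x u y} → Sound S → Reach (summaryFSA S q m) x u y →
               ∀ w → ∃ λ τ → Steps′ (x , u ++ w) τ (y , w)
  Reach-pops sound done w = [] , done
  Reach-pops {S} sound (stepa {x} {z} {γ} {u} e r) w
    with sound (x , γ , z) (does-true⇒ (encode (x , γ , z) ∈? S) e) (u ++ w) | Reach-pops sound r w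
  ... | τ₁ , s₁ | τ₂ , s₂ = τ₁ ++ τ₂ , s₁ ◅◅ s₂

  derivable-pops : ∀ {S} → Sound S → ∀ t → Derivable S t → PopSummary t
  derivable-pops sound (p , γ , m) (a , q , u , (x , x≡m , r) , d) w
    with does-true⇒ (x ≟ᶠ m) x≡m
  ... | refl with Reach-pops sound r w
  ... | τ , s = fromMaybe a ++ τ , step d ◅ s

  -- A step pops γ and pushes u; the rest of the run consumes u down to some
  -- state z, which makes (p, γ, z) derivable and hence an edge.
  Reach-backward : ∀ {S q m p v a q′ v′ p′} → Closed S → Step 𝒫 (p , v) a (q′ , v′) →
                   Reach (summaryFSA S q m) q′ v′ p′ → Reach (summaryFSA S q m) p v p′
  Reach-backward {S} closed (step {p} {γ} {a} {q} {u} d) r with Reach-split u r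
  ... | z , r₁ , r₂ = stepa (dec-true (encode (p , γ , z) ∈? S) edge) r₂
    where
    edge : encode (p , γ , z) ∈ S
    edge = closed (p , γ , z) (a , q , u , (z , dec-true (z ≟ᶠ z) refl , Reach-retarget r₁) , d)

  Steps-reach : ∀ {S q m p v τ p′} → Closed S → Steps′ (p , v) τ (p′ , []) → Reach (summaryFSA S q m) p v p′
  Steps-reach closed done        = done
  Steps-reach closed (stepε s r) = Reach-backward closed s (Steps-reach closed r)
  Steps-reach closed (stepa s r) = Reach-backward closed s (Steps-reach closed r)

  Reach-[γ] : ∀ {S q m x γ y} → Reach (summaryFSA S q m) x (γ ∷ []) y → encode (x , γ , y) ∈ S
  Reach-[γ] {S} {x = x} {γ} (stepa e done) = does-true⇒ (encode (x , γ , _) ∈? S) e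

  nonempty-summary : ∀ {S} → Sound S → Closed S →
                     (∃ λ τ → InLang 𝒫 τ) → ∃ λ p → F p ≡ true × encode (p₀ , γ₀ , p) ∈ S
  nonempty-summary {S} sound closed (τ , p , Fp , run) =
    p , Fp , Reach-[γ] (Steps-reach {S} {p₀} {p₀} closed run)

  summary-nonempty : ∀ {S} → Sound S → (∃ λ p → F p ≡ true × encode (p₀ , γ₀ , p) ∈ S) → ∃ λ τ → InLang 𝒫 τ
  summary-nonempty sound (p , Fp , t∈S) with sound (p₀ , γ₀ , p) t∈S []
  ... | τ , run = τ , p , Fp , run

  pop-summaries : Effective 𝒫 → ∃ λ S → Sound S × Closed S
  pop-summaries eff =
    let S , good , saturated = saturate (λ good → derivable-pops (AllGood⇒Sound good) _)
                                        ⊥ (λ i∈⊥ → ⊥-elim (∉⊥ i∈⊥))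
    in S , AllGood⇒Sound good , (λ t d → saturated (subst (Derivable S) (sym (decode-encode t)) d))
    where
    open Saturation (λ S i → Derivable S (decode i)) (λ S i → derivable? eff S (decode i))
                    (λ i → PopSummary (decode i))
    AllGood⇒Sound : ∀ {S} → AllGood S → Sound S
    AllGood⇒Sound good t t∈S = subst PopSummary (decode-encode t) (good t∈S)

  nonempty? : Effective 𝒫 → Dec (∃ λ τ → InLang 𝒫 τ)
  nonempty? eff =
    let S , sound , closed = pop-summaries eff
    in map′ (summary-nonempty sound) (nonempty-summary sound closed)
            (any? λ p → (F p ≟ᵇ true) ×-dec (encode (p₀ , γ₀ , p) ∈? S))

theorem2p7 : (𝒫 : GPA) → Effective 𝒫 → Dec (LangEmpty 𝒫)
theorem2p7 𝒫 eff =
  map′ (λ ¬nonempty τ w → ¬nonempty (τ , w)) (λ empty (τ , w) → empty τ w) (¬? (nonempty? 𝒫 eff))
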